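{- Let $k$ be a positive integer and let $G$ be a connected graph with vertex set $\{v_1,\dots,v_n\}$. If $$|E(G)|>k\left(1+\max_{P\in\mathbf{P}}\sum_{v\in V(P)}\big(d_{\widehat{G}}(v)-1\big)\right),$$ where $\mathbf{P}$ is the set of all shortest paths in $S(G)$ connecting two vertices of the form $w_{ij}$, then $\mu_{\mathrm{int}}(\widehat{G})>k$.
   Context: Graphs are finite and simple; $d_H(v)$ is the degree of $v$ in $H$. A $k$-improper edge coloring of a graph $H$ is a map $\alpha:E(H)\to\mathbb{N}$ such that at most $k$ edges with a common endpoint receive the same color; it is an improper interval coloring if at every vertex the colors on incident edges form a set of consecutive integers. $\mu_{\mathrm{int}}(H)$ is the smallest $k$ such that $H$ has a $k$-improper interval edge coloring. For a graph $G$ with $V(G)=\{v_1,\dots,v_n\}$, $S(G)$ is the graph obtained by subdividing every edge: $V(S(G))=\{v_1,\dots,v_n\}\cup\{w_{ij}:v_iv_j\in E(G)\}$, $E(S(G))=\{v_iw_{ij},v_jw_{ij}:v_iv_j\in E(G)\}$. The graph $\widehat{G}$ is obtained from $S(G)$ by adding a new vertex $u$ and the edges $uw_{ij}$ for all $v_iv_j\in E(G)$. -}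

module Defs where

open import Data.Nat using (ℕ; _≤_; _∸_)
open import Data.Nat.Properties using () renaming (_≟_ to _≟ℕ_)
open import Data.Fin using (Fin; splitAt)
open import Data.Fin.Properties using () renaming (_≟_ to _≟F_)
open import Data.Unit using (⊤; tt)
open import Data.Unit.Properties using () renaming (_≟_ to _≟⊤_)
open import Data.Product using (_×_; _,_; proj₁; proj₂; Σ; ∃; ∃-syntax; swap)
open import Data.Sum using (_⊎_; inj₁; inj₂; [_,_]′)
open import Data.Sum.Properties using (≡-dec)
open import Data.List using (List; length; filter; map; head; last)
open import Data.Nat.ListAction using (sum)
open import Data.Fin.Base using ()
open import Data.List using (allFin)
open import Data.List.Relation.Unary.Linked using (Linked)
open import Data.List.Relation.Unary.Unique.Propositional using (Unique)
open import Data.Maybe using (Maybe; just)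
open import Relation.Binary.PropositionalEquality using (_≡_; _≢_)
open import Relation.Binary.Definitions using (DecidableEquality)
open import Relation.Nullary using (Dec; ¬_)
open import Relation.Nullary.Decidable using (_⊎-dec_; _×-dec_)

record Graph (V : Set) : Set where
  field
    nE   : ℕ
    ends : Fin nE → V × V
open Graph public

IsSimple : ∀ {V} → Graph V → Set
IsSimple G =
  (∀ a → proj₁ (ends G a) ≢ proj₂ (ends G a)) ×
  (∀ a b → (ends G a ≡ ends G b ⊎ ends G a ≡ swap (ends G b)) → a ≡ b)

Incident : ∀ {V} (G : Graph V) → V → Fin (nE G) → Set
Incident G v a = v ≡ proj₁ (ends G a) ⊎ v ≡ proj₂ (ends G a)

incident? : ∀ {V} → DecidableEquality V → (G : Graph V) → (v : V) → (a : Fin (nE G)) → Dec (Incident G v a)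
incident? _≟_ G v a = (v ≟ proj₁ (ends G a)) ⊎-dec (v ≟ proj₂ (ends G a))

degree : ∀ {V} → DecidableEquality V → (G : Graph V) → V → ℕ
degree _≟_ G v = length (filter (incident? _≟_ G v) (allFin (nE G)))

Adj : ∀ {V} → Graph V → V → V → Set
Adj G x y = ∃[ a ] (ends G a ≡ (x , y) ⊎ ends G a ≡ (y , x))

IsWalk : ∀ {V} → Graph V → V → V → List V → Set
IsWalk G x y ws = Linked (Adj G) ws × head ws ≡ just x × last ws ≡ just y

IsPath : ∀ {V} → Graph V → V → V → List V → Set
IsPath G x y ps = IsWalk G x y ps × Unique ps

IsShortestPath : ∀ {V} → Graph V → V → V → List V → Set
IsShortestPath G x y ps = IsPath G x y ps × (∀ ws → IsWalk G x y ws → length ps ≤ length ws)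

Connected : ∀ {V} → Graph V → Set
Connected G = ∀ x y → ∃[ ws ] IsWalk G x y ws

-- S(G): vertices v_i = inj₁ i, w_a = inj₂ a (one for each edge a = v_i v_j);
-- edges v_i w_a (first m) and v_j w_a (next m)
S : ∀ {n} → (G : Graph (Fin n)) → Graph (Fin n ⊎ Fin (nE G))
S {n} G = record
  { nE = nE G Data.Nat.+ nE G
  ; ends = λ e → [ (λ a → inj₁ (proj₁ (ends G a)) , inj₂ a)
                 , (λ a → inj₁ (proj₂ (ends G a)) , inj₂ a) ]′ (splitAt (nE G) e) }

-- Ĝ: S(G) plus new vertex u = inj₂ tt and edges u w_a
Hat : ∀ {n} → (G : Graph (Fin n)) → Graph ((Fin n ⊎ Fin (nE G)) ⊎ ⊤)
Hat G = record
  { nE = nE (S G) Data.Nat.+ nE G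
  ; ends = λ e → [ (λ b → inj₁ (proj₁ (ends (S G) b)) , inj₁ (proj₂ (ends (S G) b)))
                 , (λ a → inj₂ tt , inj₁ (inj₂ a)) ]′ (splitAt (nE (S G)) e) }

hatVtx-≟ : ∀ {n m} → DecidableEquality ((Fin n ⊎ Fin m) ⊎ ⊤)
hatVtx-≟ = ≡-dec (≡-dec _≟F_ _≟F_) _≟⊤_

IsImproper : ∀ {V} → DecidableEquality V → ℕ → (H : Graph V) → (Fin (nE H) → ℕ) → Set
IsImproper _≟_ k H α =
  ∀ v c → length (filter (λ a → incident? _≟_ H v a ×-dec (α a ≟ℕ c)) (allFin (nE H))) ≤ k

IsInterval : ∀ {V} → (H : Graph V) → (Fin (nE H) → ℕ) → Set
IsInterval H α = ∀ v a b c → Incident H v a → Incident H v b → α a ≤ c → c ≤ α b →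
  ∃[ e ] (Incident H v e × α e ≡ c)

HasImproperInterval : ∀ {V} → DecidableEquality V → ℕ → Graph V → Set
HasImproperInterval _≟_ k H = ∃[ α ] (IsImproper _≟_ k H α × IsInterval H α)

μintGreaterThan : ∀ {V} → DecidableEquality V → Graph V → ℕ → Set
μintGreaterThan _≟_ H k = ∀ j → j ≤ k → ¬ HasImproperInterval _≟_ j H

InP : ∀ {n} (G : Graph (Fin n)) → List (Fin n ⊎ Fin (nE G)) → Set
InP G ps = ∃[ a ] ∃[ b ] (a ≢ b × IsShortestPath (S G) (inj₂ a) (inj₂ b) ps)

weight : ∀ {n} (G : Graph (Fin n)) → List (Fin n ⊎ Fin (nE G)) → ℕ
weight G ps = sum (map (λ v → degree hatVtx-≟ (Hat G) (inj₁ v) ∸ 1) ps)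

IsMaxWeight : ∀ {n} (G : Graph (Fin n)) → ℕ → Set
IsMaxWeight G M = (∃[ P ] (InP G P × weight G P ≡ M)) × (∀ P → InP G P → weight G P ≤ M)

-- In an interval colouring the colours at a vertex v span at most d(v) − 1, so along a walk
-- v₁ … v_r of Ĝ the colours of an edge at v₁ and of an edge at v_r differ by at most
-- Σ (d(vᵢ) − 1). Applied to a shortest path of S(G) from w_a to w_b, this puts the colours of
-- all edges u w_a at the apex u within M of each other; the |E(G)| edges at u thus use at most
-- 1 + M colours, each at most k times, so |E(G)| ≤ k (1 + M).

module Submission where

open import Defs
open import Data.Fin using (Fin; toℕ; fromℕ<; _↑ˡ_; _↑ʳ_; splitAt; join)
open import Data.Fin.Properties
  using ( pigeonhole; any?; toℕ<n; toℕ-injective; toℕ-fromℕ<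
        ; splitAt-↑ˡ; splitAt-↑ʳ; join-splitAt; ↑ʳ-injective )
  renaming (<⇒≢ to <⇒≢ᶠ; _≟_ to _≟ᶠ_)
import Data.List as List
open import Data.List using (List; []; _∷_; length; filter; map; allFin)
open import Data.List.Extrema.Nat using (argmin; f[argmin]≤f[xs])
open import Data.List.Membership.Propositional using (_∈_)
open import Data.List.Membership.Propositional.Properties using (∈-filter⁺; ∈-allFin)
import Data.List.Membership.DecPropositional as DecMembership
open import Data.List.Properties using (filter-none; map-∘; last-map)
open import Data.List.Relation.Binary.Sublist.Propositional using (⊆-refl)
open import Data.List.Relation.Binary.Sublist.Propositional.Properties using (filter⁺; length-mono-≤)
open import Data.List.Relation.Unary.All as All using ([])
open import Data.List.Relation.Unary.All.Properties.Core using (¬Any⇒All¬)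
open import Data.List.Relation.Unary.AllPairs using ([]; _∷_)
open import Data.List.Relation.Unary.Any as Any using (here; there)
open import Data.List.Relation.Unary.Any.Properties using (lookup-index)
import Data.List.Relation.Unary.Linked as Linked
open import Data.List.Relation.Unary.Linked using ([-]; _∷_)
open import Data.List.Relation.Unary.Linked.Properties using (map⁺)
import Data.Maybe as Maybe
open import Data.Nat using (ℕ; zero; suc; _≤_; _<_; _*_; _+_; _∸_; z≤n; s≤s; _≤?_)
open import Data.Nat.Induction using (<-wellFounded)
open import Data.Nat.ListAction using (sum)
open import Data.Nat.Properties
open import Data.Product using (_×_; _,_; proj₁; proj₂; ∃; ∃-syntax)
import Data.Product as Product
import Data.Product.Properties as Product
open import Data.Sum using (_⊎_; inj₁; inj₂; [_,_]′)
import Data.Sum.Properties as Sum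
open import Data.Unit using (⊤; tt)
open import Function using (_∘_)
open import Function.Definitions using (Injective)
open import Induction.WellFounded using (Acc; acc)
open import Level using (0ℓ)
open import Relation.Binary.Definitions using (DecidableEquality)
open import Relation.Binary.PropositionalEquality
open import Relation.Nullary using (Dec; yes; no; ¬_; ¬?)
open import Relation.Nullary.Decidable using (map′; _×-dec_; _⊎-dec_)
open import Relation.Unary using (Pred; Decidable)

module _ {A : Set} where

  injection⇒≤length : ∀ {d} {xs : List A} (f : Fin d → A) → Injective _≡_ _≡_ f →
                      (∀ i → f i ∈ xs) → d ≤ length xs
  injection⇒≤length {xs = xs} f f-injective f∈xs = ≮⇒≥ λ |xs|<d →
    let (i , j , i<j , same-index) = pigeonhole |xs|<d (Any.index ∘ f∈xs) in
    <⇒≢ᶠ i<j (f-injective (begin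
      f i                ≡⟨ lookup-index (f∈xs i) ⟩
      List.lookup xs _   ≡⟨ cong (List.lookup xs) same-index ⟩
      List.lookup xs _   ≡⟨ lookup-index (f∈xs j) ⟨
      f j                ∎))
    where open ≡-Reasoning

  module _ {P Q : Pred A 0ℓ} (P? : Decidable P) (Q? : Decidable Q) where

    length-filter-split : ∀ xs → length (filter P? xs) ≡
      length (filter (λ x → P? x ×-dec Q? x) xs) + length (filter (λ x → P? x ×-dec ¬? (Q? x)) xs)
    length-filter-split [] = refl
    length-filter-split (x ∷ xs) with P? x | Q? x
    ... | yes _ | yes _ = cong suc (length-filter-split xs)
    ... | yes _ | no  _ = trans (cong suc (length-filter-split xs)) (sym (+-suc _ _))
    ... | no  _ | _     = length-filter-split xs

    length-filter-mono : (∀ {x} → P x → Q x) → ∀ xs → length (filter P? xs) ≤ length (filter Q? xs)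
    length-filter-mono P⇒Q xs = length-mono-≤ (filter⁺ P? Q? (λ { refl → P⇒Q }) (⊆-refl {x = xs}))

  count-in-window : ∀ {P : Pred A 0ℓ} (P? : Decidable P) (c : A → ℕ) (xs : List A) {j} s d →
    (∀ {x} → P x → s ≤ c x × c x < s + d) →
    (∀ v → length (filter (λ x → P? x ×-dec (c x ≟ v)) xs) ≤ j) →
    length (filter P? xs) ≤ d * j
  count-in-window {P = P} P? c xs s zero window count≤j =
    ≤-reflexive (cong length (filter-none P? (All.universal outside xs)))
    where
    outside : ∀ x → ¬ P x
    outside x Px = let (s≤cx , cx<s+0) = window Px in
      <⇒≱ cx<s+0 (≤-trans (≤-reflexive (+-identityʳ s)) s≤cx)
  count-in-window {P = P} P? c xs {j} s (suc d) window count≤j = begin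
    length (filter P? xs)
      ≡⟨ length-filter-split P? (λ x → c x ≟ s) xs ⟩
    length (filter (λ x → P? x ×-dec (c x ≟ s)) xs) + length (filter P′? xs)
      ≤⟨ +-mono-≤ (count≤j s) (count-in-window P′? c xs (suc s) d window′ count′≤j) ⟩
    j + d * j
      ∎
    where
    open ≤-Reasoning
    P′? : Decidable (λ x → P x × ¬ c x ≡ s)
    P′? x = P? x ×-dec ¬? (c x ≟ s)
    window′ : ∀ {x} → P x × ¬ c x ≡ s → suc s ≤ c x × c x < suc s + d
    window′ {x} (Px , cx≢s) = let (s≤cx , cx<s+1+d) = window Px in
      ≤∧≢⇒< s≤cx (cx≢s ∘ sym) , subst (c x <_) (+-suc s d) cx<s+1+d
    count′≤j : ∀ v → length (filter (λ x → P′? x ×-dec (c x ≟ v)) xs) ≤ j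
    count′≤j v = ≤-trans (length-filter-mono _ _ (λ ((Px , _) , cx≡v) → Px , cx≡v) xs) (count≤j v)

Adj-sym : ∀ {V} {G : Graph V} {x z} → Adj G x z → Adj G z x
Adj-sym (e , inj₁ e≡xz) = e , inj₂ e≡xz
Adj-sym (e , inj₂ e≡zx) = e , inj₁ e≡zx

IsWalk-map : ∀ {V W} {G : Graph V} {H : Graph W} (f : V → W) → (∀ {x z} → Adj G x z → Adj H (f x) (f z)) →
             ∀ {x y ws} → IsWalk G x y ws → IsWalk H (f x) (f y) (map f ws)
IsWalk-map f hom {ws = _ ∷ ws} (linked , refl , last≡y) =
  map⁺ (Linked.map hom linked) , refl , trans (last-map f (_ ∷ ws)) (cong (Maybe.map f) last≡y)

Adj⇒common-edge : ∀ {V} {H : Graph V} {x z} → Adj H x z → ∃[ e ] (Incident H x e × Incident H z e)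
Adj⇒common-edge (e , inj₁ e≡xz) = e , inj₁ (sym (cong proj₁ e≡xz)) , inj₂ (sym (cong proj₂ e≡xz))
Adj⇒common-edge (e , inj₂ e≡zx) = e , inj₂ (sym (cong proj₂ e≡zx)) , inj₁ (sym (cong proj₁ e≡zx))

module _ {V : Set} (_≟_ : DecidableEquality V) (search : ∀ {P : Pred V 0ℓ} → Decidable P → Dec (∃ P))
         (G : Graph V) where

  open DecMembership _≟_ using (_∈?_)

  Adj? : ∀ x z → Dec (Adj G x z)
  Adj? x z = any? λ e → (≡-pair (ends G e) (x , z)) ⊎-dec (≡-pair (ends G e) (z , x))
    where
    ≡-pair : DecidableEquality (V × V)
    ≡-pair = Product.≡-dec _≟_ _≟_

  WalkOfLength : V → V → ℕ → Set
  WalkOfLength x y ℓ = ∃[ ws ] (IsWalk G x y ws × length ws ≡ ℓ)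

  walk-of-length? : ∀ ℓ x y → Dec (WalkOfLength x y ℓ)
  walk-of-length? zero x y = no λ { ([] , (_ , () , _) , _) }
  walk-of-length? (suc zero) x y with x ≟ y
  ... | yes refl = yes (x ∷ [] , ([-] , refl , refl) , refl)
  ... | no  x≢y  = no λ { (_ ∷ [] , (_ , refl , refl) , _) → x≢y refl }
  walk-of-length? (suc (suc ℓ)) x y with search (λ z → Adj? x z ×-dec walk-of-length? (suc ℓ) z y)
  ... | yes (z , xz , (_ ∷ ws , (linked , refl , last≡y) , |ws|≡ℓ)) =
        yes (x ∷ z ∷ ws , (xz ∷ linked , refl , last≡y) , cong suc |ws|≡ℓ)
  ... | no  none = no λ { (_ ∷ z ∷ ws , (xz ∷ linked , refl , last≡y) , |ws|≡ℓ) →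
                           none (z , xz , (z ∷ ws , (linked , refl , last≡y) , suc-injective |ws|≡ℓ)) }

  shortest-walk : ∀ {x y ws} → IsWalk G x y ws →
                  ∃[ ws′ ] (IsWalk G x y ws′ × (∀ vs → IsWalk G x y vs → length ws′ ≤ length vs))
  shortest-walk {x} {y} {ws} walk = go walk (<-wellFounded (length ws))
    where
    go : ∀ {ws} → IsWalk G x y ws → Acc _<_ (length ws) →
         ∃[ ws′ ] (IsWalk G x y ws′ × (∀ vs → IsWalk G x y vs → length ws′ ≤ length vs))
    go {ws} walk (acc shorter) with any? (λ (i : Fin (length ws)) → walk-of-length? (toℕ i) x y)
    ... | yes (i , vs , walk′ , |vs|≡i) = go walk′ (shorter (subst (_< length ws) (sym |vs|≡i) (toℕ<n i)))
    ... | no  none = ws , walk , λ vs walk′ → ≮⇒≥ λ |vs|<|ws| →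
                       none (fromℕ< |vs|<|ws| , vs , walk′ , sym (toℕ-fromℕ< |vs|<|ws|))

  suffix-path : ∀ {x y p ps} → x ∈ p ∷ ps → IsPath G p y (p ∷ ps) →
                ∃[ qs ] (IsPath G x y qs × length qs ≤ length (p ∷ ps))
  suffix-path (here refl) path = _ , path , ≤-refl
  suffix-path {ps = p′ ∷ ps} (there x∈ps) ((_ ∷ linked , refl , last≡y) , _ ∷ unique)
    with qs , path , |qs|≤ ← suffix-path x∈ps ((linked , refl , last≡y) , unique) =
    qs , path , m≤n⇒m≤1+n |qs|≤

  walk⇒path : ∀ {x y} ws → IsWalk G x y ws → ∃[ ps ] (IsPath G x y ps × length ps ≤ length ws)
  walk⇒path (x ∷ []) walk@([-] , refl , _) = x ∷ [] , (walk , [] ∷ []) , ≤-refl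
  walk⇒path (x ∷ z ∷ rest) (xz ∷ linked , refl , last≡y)
    with walk⇒path (z ∷ rest) (linked , refl , last≡y)
  ... | p ∷ ps , path@((linked′ , refl , last≡y′) , unique) , |ps|≤ with x ∈? p ∷ ps
  ...   | yes x∈ps = let (qs , path′ , |qs|≤) = suffix-path x∈ps path in
                     qs , path′ , m≤n⇒m≤1+n (≤-trans |qs|≤ |ps|≤)
  ...   | no  x∉ps =
    x ∷ p ∷ ps , ((xz ∷ linked′ , refl , last≡y′) , ¬Any⇒All¬ _ x∉ps ∷ unique) , s≤s |ps|≤

  shortest-path : ∀ {x y ws} → IsWalk G x y ws → ∃[ ps ] IsShortestPath G x y ps
  shortest-path walk with ws , walk′ , minimal ← shortest-walk walk
                     with ps , path , |ps|≤ ← walk⇒path ws walk′ =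
    ps , path , λ vs walk″ → ≤-trans |ps|≤ (minimal vs walk″)

any?-⊎ : ∀ {a b} {P : Pred (Fin a ⊎ Fin b) 0ℓ} → Decidable P → Dec (∃ P)
any?-⊎ P? = map′ [ (λ (i , p) → inj₁ i , p) , (λ (i , p) → inj₂ i , p) ]′
                 (λ { (inj₁ i , p) → inj₁ (i , p) ; (inj₂ i , p) → inj₂ (i , p) })
                 (any? (P? ∘ inj₁) ⊎-dec any? (P? ∘ inj₂))

excess : ∀ {V} → DecidableEquality V → Graph V → List V → ℕ
excess _≟_ H ws = sum (map (λ v → degree _≟_ H v ∸ 1) ws)

module _ {V : Set} (_≟_ : DecidableEquality V) (H : Graph V)
         {α : Fin (nE H) → ℕ} (interval : IsInterval H α) where

  colour-spread : ∀ {v f g} → Incident H v f → Incident H v g →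
                  α g ≤ α f + (degree _≟_ H v ∸ 1)
  colour-spread {v} {f} {g} v∈f v∈g with α g ≤? α f
  ... | yes αg≤αf = ≤-trans αg≤αf (m≤m+n _ _)
  ... | no  αg≰αf = begin
      α g                          ≡⟨ m+[n∸m]≡n αf≤αg ⟨
      α f + (α g ∸ α f)            ≤⟨ +-monoʳ-≤ (α f) (∸-monoˡ-≤ 1 width≤degree) ⟩
      α f + (degree _≟_ H v ∸ 1)   ∎
    where
    open ≤-Reasoning
    αf≤αg : α f ≤ α g
    αf≤αg = <⇒≤ (≰⇒> αg≰αf)
    realise : (i : Fin (suc (α g ∸ α f))) → ∃[ e ] (Incident H v e × α e ≡ α f + toℕ i)
    realise i = interval v f g (α f + toℕ i) v∈f v∈g (m≤m+n _ _) (begin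
      α f + toℕ i         ≤⟨ +-monoʳ-≤ (α f) (≤-pred (toℕ<n i)) ⟩
      α f + (α g ∸ α f)   ≡⟨ m+[n∸m]≡n αf≤αg ⟩
      α g                 ∎)
    realise-injective : Injective _≡_ _≡_ (proj₁ ∘ realise)
    realise-injective {i} {j} same = toℕ-injective (+-cancelˡ-≡ (α f) _ _ (begin-equality
      α f + toℕ i                 ≡⟨ proj₂ (proj₂ (realise i)) ⟨
      α (proj₁ (realise i))       ≡⟨ cong α same ⟩
      α (proj₁ (realise j))       ≡⟨ proj₂ (proj₂ (realise j)) ⟩
      α f + toℕ j                 ∎))
    width≤degree : suc (α g ∸ α f) ≤ degree _≟_ H v
    width≤degree = injection⇒≤length (proj₁ ∘ realise) realise-injective
      (λ i → ∈-filter⁺ (incident? _≟_ H v) (∈-allFin _) (proj₁ (proj₂ (realise i))))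

  walk-colour-bound : ∀ {x y ws f g} → IsWalk H x y ws → Incident H x f → Incident H y g →
                      α g ≤ α f + excess _≟_ H ws
  walk-colour-bound {ws = x ∷ []} {f} {g} ([-] , refl , refl) x∈f x∈g =
    subst (α g ≤_) (cong (α f +_) (sym (+-identityʳ _))) (colour-spread x∈f x∈g)
  walk-colour-bound {ws = x ∷ z ∷ rest} {f} {g} (xz ∷ linked , refl , last≡y) x∈f y∈g =
    let (h , x∈h , z∈h) = Adj⇒common-edge xz in begin
      α g                                                  ≤⟨ walk-colour-bound {ws = z ∷ rest} (linked , refl , last≡y) z∈h y∈g ⟩
      α h + excess _≟_ H (z ∷ rest)                        ≤⟨ +-monoˡ-≤ _ (colour-spread x∈f x∈h) ⟩
      α f + (degree _≟_ H x ∸ 1) + excess _≟_ H (z ∷ rest) ≡⟨ +-assoc (α f) _ _ ⟩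
      α f + excess _≟_ H (x ∷ z ∷ rest)                    ∎
    where open ≤-Reasoning

module _ {n : ℕ} (G : Graph (Fin n)) where

  uw : Fin (nE G) → Fin (nE (Hat G))
  uw a = nE (S G) ↑ʳ a

  ends-S-first : ∀ a → ends (S G) (a ↑ˡ nE G) ≡ (inj₁ (proj₁ (ends G a)) , inj₂ a)
  ends-S-first a rewrite splitAt-↑ˡ (nE G) a (nE G) = refl

  ends-S-second : ∀ a → ends (S G) (nE G ↑ʳ a) ≡ (inj₁ (proj₂ (ends G a)) , inj₂ a)
  ends-S-second a rewrite splitAt-↑ʳ (nE G) (nE G) a = refl

  ends-Hat-S : ∀ s → ends (Hat G) (s ↑ˡ nE G) ≡ (inj₁ (proj₁ (ends (S G) s)) , inj₁ (proj₂ (ends (S G) s)))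
  ends-Hat-S s rewrite splitAt-↑ˡ (nE (S G)) s (nE G) = refl

  ends-uw : ∀ a → ends (Hat G) (uw a) ≡ (inj₂ tt , inj₁ (inj₂ a))
  ends-uw a rewrite splitAt-↑ʳ (nE (S G)) (nE G) a = refl

  uw-incident-w : ∀ a → Incident (Hat G) (inj₁ (inj₂ a)) (uw a)
  uw-incident-w a = inj₂ (sym (cong proj₂ (ends-uw a)))

  uw-incident-u : ∀ a → Incident (Hat G) (inj₂ tt) (uw a)
  uw-incident-u a = inj₁ (sym (cong proj₁ (ends-uw a)))

  incident-u⇒uw : ∀ {e} → Incident (Hat G) (inj₂ tt) e → ∃[ a ] (e ≡ uw a)
  incident-u⇒uw {e} u∈e with splitAt (nE (S G)) e in split≡ | u∈e
  ... | inj₁ _ | inj₁ ()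
  ... | inj₁ _ | inj₂ ()
  ... | inj₂ a | _ = a , trans (sym (join-splitAt (nE (S G)) (nE G) e)) (cong (join (nE (S G)) (nE G)) split≡)

  S-adj⇒Hat-adj : ∀ {x z} → Adj (S G) x z → Adj (Hat G) (inj₁ x) (inj₁ z)
  S-adj⇒Hat-adj (s , inj₁ s≡xz) =
    s ↑ˡ nE G , inj₁ (trans (ends-Hat-S s) (cong (Product.map inj₁ inj₁) s≡xz))
  S-adj⇒Hat-adj (s , inj₂ s≡zx) =
    s ↑ˡ nE G , inj₂ (trans (ends-Hat-S s) (cong (Product.map inj₁ inj₁) s≡zx))

  weight≡excess : ∀ ps → weight G ps ≡ excess hatVtx-≟ (Hat G) (map inj₁ ps)
  weight≡excess ps = cong sum (map-∘ ps)

  G-adj⇒S-walk : ∀ {x z} → Adj G x z → ∃[ a ] (Adj (S G) (inj₁ x) (inj₂ a) × Adj (S G) (inj₂ a) (inj₁ z))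
  G-adj⇒S-walk (a , inj₁ refl) =
    a , (a ↑ˡ nE G , inj₁ (ends-S-first a)) , Adj-sym (nE G ↑ʳ a , inj₁ (ends-S-second a))
  G-adj⇒S-walk (a , inj₂ refl) =
    a , (nE G ↑ʳ a , inj₁ (ends-S-second a)) , Adj-sym (a ↑ˡ nE G , inj₁ (ends-S-first a))

  -- The endpoint t is threaded through so that the subdivided walk never has to be extended.
  subdivide-walk : ∀ {x y t ws} → IsWalk G x y ws → Adj (S G) (inj₁ y) t →
                   ∃[ vs ] IsWalk (S G) (inj₁ x) t (inj₁ x ∷ vs)
  subdivide-walk {t = t} {ws = x ∷ []} ([-] , refl , refl) yt = t ∷ [] , (yt ∷ [-] , refl , refl)
  subdivide-walk {ws = x ∷ z ∷ rest} (xz ∷ linked , refl , last≡y) yt =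
    let (vs , linked′ , _ , last≡t) = subdivide-walk {ws = z ∷ rest} (linked , refl , last≡y) yt
        (a , xa , az) = G-adj⇒S-walk xz
    in inj₂ a ∷ inj₁ z ∷ vs , (xa ∷ az ∷ linked′ , refl , last≡t)

  S-walk-between-edges : Connected G → ∀ a b → ∃[ ws ] IsWalk (S G) (inj₂ a) (inj₂ b) ws
  S-walk-between-edges connected a b =
    let (ws , walk) = connected (proj₁ (ends G a)) (proj₁ (ends G b))
        (vs , linked , _ , last≡b) = subdivide-walk walk (first-end-adj b)
    in inj₂ a ∷ inj₁ (proj₁ (ends G a)) ∷ vs , (Adj-sym (first-end-adj a) ∷ linked , refl , last≡b)
    where
    first-end-adj : ∀ c → Adj (S G) (inj₁ (proj₁ (ends G c))) (inj₂ c)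
    first-end-adj c = c ↑ˡ nE G , inj₁ (ends-S-first c)

  colours-at-u-within : Connected G → ∀ {M} → (∀ P → InP G P → weight G P ≤ M) →
                        ∀ {α} → IsInterval (Hat G) α → ∀ a b → α (uw b) ≤ α (uw a) + M
  colours-at-u-within connected {M} maximal {α} interval a b with a ≟ᶠ b
  ... | yes refl = m≤m+n _ _
  ... | no  a≢b =
    let (_ , walk) = S-walk-between-edges connected a b
        (ps , shortest) = shortest-path (Sum.≡-dec _≟ᶠ_ _≟ᶠ_) any?-⊎ (S G) walk
    in begin
      α (uw b)                                        ≤⟨ walk-colour-bound hatVtx-≟ (Hat G) interval
                                                           (IsWalk-map inj₁ S-adj⇒Hat-adj (proj₁ (proj₁ shortest)))
                                                           (uw-incident-w a) (uw-incident-w b) ⟩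
      α (uw a) + excess hatVtx-≟ (Hat G) (map inj₁ ps) ≡⟨ cong (α (uw a) +_) (weight≡excess ps) ⟨
      α (uw a) + weight G ps                          ≤⟨ +-monoʳ-≤ (α (uw a)) (maximal ps (a , b , a≢b , shortest)) ⟩
      α (uw a) + M                                    ∎
    where open ≤-Reasoning

theorem10 : (k : ℕ) → 1 ≤ k → (n : ℕ) → (G : Graph (Fin n)) → IsSimple G → Connected G →
    (M : ℕ) → IsMaxWeight G M → k * (1 + M) < nE G →
    μintGreaterThan hatVtx-≟ (Hat G) k
theorem10 k _ n G _ connected M (_ , maximal) k[1+M]<m j j≤k (α , improper , interval) =
  <⇒≱ k[1+M]<m (begin
    nE G                                   ≤⟨ injection⇒≤length (uw G) (↑ʳ-injective _ _ _) uw∈u-edges ⟩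
    length (filter u-incident? (allFin _)) ≤⟨ count-in-window u-incident? α (allFin _) s (1 + M) window (improper u) ⟩
    (1 + M) * j                            ≤⟨ *-monoʳ-≤ (1 + M) j≤k ⟩
    (1 + M) * k                            ≡⟨ *-comm (1 + M) k ⟩
    k * (1 + M)                            ∎)
  where
  open ≤-Reasoning
  u : (Fin n ⊎ Fin (nE G)) ⊎ ⊤
  u = inj₂ tt
  u-incident? : Decidable (Incident (Hat G) u)
  u-incident? = incident? hatVtx-≟ (Hat G) u
  uw∈u-edges : ∀ a → uw G a ∈ filter u-incident? (allFin _)
  uw∈u-edges a = ∈-filter⁺ u-incident? (∈-allFin _) (uw-incident-u G a)
  a-min : Fin (nE G)
  a-min = argmin (α ∘ uw G) (fromℕ< (≤-<-trans z≤n k[1+M]<m)) (allFin _)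
  s : ℕ
  s = α (uw G a-min)
  window : ∀ {e} → Incident (Hat G) u e → s ≤ α e × α e < s + (1 + M)
  window u∈e with a , refl ← incident-u⇒uw G u∈e =
    All.lookup (f[argmin]≤f[xs] _ (allFin _)) (∈-allFin a) ,
    ≤-<-trans (colours-at-u-within G connected maximal interval a-min a) (+-monoʳ-< s (n<1+n M))
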